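{- Let $\mathcal{L}$ be a finite FOLDS signature. Then $\mathrm{Struc}(\mathcal{L})$ is a closed type, i.e. the judgment $\vdash\mathrm{Struc}(\mathcal{L})\ \mathbf{Type}$ is derivable in MLTT.
   Context: A FOLDS signature is an inverse category $\mathcal{L}$ (skeletal, no non-identity endomorphisms, each object the domain of finitely many arrows) with a proper order: a partial order $<$ on objects with $K_f<K$ for every non-identity $f\colon K\to K_f$, and a partial order on arrows with $f<g$ whenever $\operatorname{cod}f<\operatorname{cod}g$; $K/\!/\mathcal{L}$ is the set of non-identity arrows with domain $K$, $K_f$ is the codomain of $f$, and indexed tuples are listed in increasing order. It is finite if it has finitely many objects and arrows. MLTT here is intensional Martin-Löf type theory with $\Pi$, $\Sigma$, the unit type $\mathbf{1}$ (with term $*$), and a universe à la Tarski $\mathcal{U}$ with decoding $\mathrm{El}$ (and $+,\mathbf{0}$). Let $K_1<\dots<K_m$ be the objects of $\mathcal{L}$. Type-theoretic variables are named by arrows of $\mathcal{L}$ (arrows that are equal as composites name the same variable). For an object $K$ with $K/\!/\mathcal{L}=\{f_1<\dots<f_n\}$ define $T_K:=\Pi(f_1:\mathrm{El}(\mathrm{app}[K_{f_1}(pf_1)_{p\in K_{f_1}/\!/\mathcal{L}}]))\cdots(f_n:\mathrm{El}(\mathrm{app}[K_{f_n}(pf_n)_{p\in K_{f_n}/\!/\mathcal{L}}]))\ \mathcal{U}$, where $\mathrm{app}[K'(q_1,\dots,q_k)]$ is the iterated application $\mathrm{app}(q_k,\dots\mathrm{app}(q_1,K')\dots)$ of the variable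 $K'$ to the variables $q_1,\dots,q_k$, and $\mathrm{app}[K'\,\epsilon]:=\mathrm{app}(*,K')$ when $K'/\!/\mathcal{L}$ is empty; if $K/\!/\mathcal{L}=\varnothing$ then $T_K:=\mathbf{1}\to\mathcal{U}$. Then $\mathrm{Struc}(\mathcal{L}):=\Sigma(K_1:T_{K_1})\cdots(K_m:T_{K_m})$ (iterated $\Sigma$-type). For example, for the signature with objects $O<A$ and two arrows $A\to O$, $\mathrm{Struc}(\mathcal{L})$ is, up to the obvious notational identifications, $\Sigma(O:\mathcal{U})(A:O\to O\to\mathcal{U})$. -}

module Defs where

open import Data.Nat using (ℕ; zero; suc; _+_; _∸_; _<ᵇ_; _≡ᵇ_; pred)
open import Data.Bool using (if_then_else_)
open import Data.Fin using (Fin; toℕ) renaming (_<_ to _<ꟳ_)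
open import Data.List using (List; []; _∷_; map; allFin; foldl)
open import Relation.Nullary using (¬_)
open import Relation.Binary.PropositionalEquality using (_≡_; subst; sym)

-- Objects are Fin m, enumerated as K_1 < ... < K_m (index order = the
-- listing used in Struc, which must be increasing for the proper order ≺).
-- For every object K, the non-identity arrows with domain K (i.e. K//L)
-- are Fin (deg K), enumerated f_1 < ... < f_n in increasing order (the
-- index order is a linear extension of the arrow order ⊏).  Distinct
-- elements of Fin (deg K) are distinct arrows; arrows equal as composites
-- are literally the same element.  Identity arrows are left implicit.
-- comp K f p is the composite  p ∘ f : K → K_p  (written  p f  in the paper)
-- for f : K → K_f and p ∈ K_f//L.

record FOLDSSig : Set₁ where
  field
    m        : ℕ
    _≺_      : Fin m → Fin m → Set
    ≺-irrefl : ∀ {K} → ¬ (K ≺ K)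
    ≺-trans  : ∀ {K K′ K″} → K ≺ K′ → K′ ≺ K″ → K ≺ K″
    ≺⇒<      : ∀ {K K′} → K ≺ K′ → K <ꟳ K′
    deg      : Fin m → ℕ
    cod      : (K : Fin m) → Fin (deg K) → Fin m
    cod≺     : ∀ K f → cod K f ≺ K
    comp     : (K : Fin m) (f : Fin (deg K)) → Fin (deg (cod K f)) → Fin (deg K)
    cod-comp : ∀ K f p → cod K (comp K f p) ≡ cod (cod K f) p
    comp-assoc : ∀ K f p q →
      comp K (comp K f p) (subst (λ X → Fin (deg X)) (sym (cod-comp K f p)) q)
        ≡ comp K f (comp (cod K f) p q)
    _⊏_      : {K : Fin m} → Fin (deg K) → Fin (deg K) → Set
    ⊏-irrefl : ∀ {K} {f : Fin (deg K)} → ¬ (f ⊏ f)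
    ⊏-trans  : ∀ {K} {f g h : Fin (deg K)} → f ⊏ g → g ⊏ h → f ⊏ h
    cod≺⇒⊏   : ∀ {K} {f g : Fin (deg K)} → cod K f ≺ cod K g → f ⊏ g
    ⊏⇒<      : ∀ {K} {f g : Fin (deg K)} → f ⊏ g → f <ꟳ g

infixr 6 _⊕_

mutual
  data Ty : Set where
    Π   : Ty → Ty → Ty
    Σ   : Ty → Ty → Ty
    𝟙   : Ty
    𝟘   : Ty
    _⊕_ : Ty → Ty → Ty
    U   : Ty
    El  : Tm → Ty

  data Tm : Set where
    var     : ℕ → Tm
    lam     : Ty → Tm → Tm
    app     : Tm → Tm → Tm
    pair    : Tm → Tm → Tm
    fst     : Tm → Tm
    snd     : Tm → Tm
    star    : Tm
    unitrec : Ty → Tm → Tm → Tm       -- motive (1 binder), case for *, scrutinee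
    inl     : Tm → Tm
    inr     : Tm → Tm
    case    : Ty → Tm → Tm → Tm → Tm  -- motive, left branch, right branch (1 binder each), scrutinee
    absurd  : Ty → Tm → Tm            -- motive (1 binder), scrutinee

mutual
  wkTy : ℕ → Ty → Ty
  wkTy c (Π A B)   = Π (wkTy c A) (wkTy (suc c) B)
  wkTy c (Σ A B)   = Σ (wkTy c A) (wkTy (suc c) B)
  wkTy c 𝟙         = 𝟙
  wkTy c 𝟘         = 𝟘
  wkTy c (A ⊕ B)   = wkTy c A ⊕ wkTy c B
  wkTy c U         = U
  wkTy c (El a)    = El (wkTm c a)

  wkTm : ℕ → Tm → Tm
  wkTm c (var n)         = if n <ᵇ c then var n else var (suc n)
  wkTm c (lam A t)       = lam (wkTy c A) (wkTm (suc c) t)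
  wkTm c (app t s)       = app (wkTm c t) (wkTm c s)
  wkTm c (pair a b)      = pair (wkTm c a) (wkTm c b)
  wkTm c (fst p)         = fst (wkTm c p)
  wkTm c (snd p)         = snd (wkTm c p)
  wkTm c star            = star
  wkTm c (unitrec C d t) = unitrec (wkTy (suc c) C) (wkTm c d) (wkTm c t)
  wkTm c (inl a)         = inl (wkTm c a)
  wkTm c (inr b)         = inr (wkTm c b)
  wkTm c (case C l r t)  = case (wkTy (suc c) C) (wkTm (suc c) l) (wkTm (suc c) r) (wkTm c t)
  wkTm c (absurd C t)    = absurd (wkTy (suc c) C) (wkTm c t)

shiftN : ℕ → Tm → Tm
shiftN zero    s = s
shiftN (suc k) s = wkTm 0 (shiftN k s)

mutual
  substTy : ℕ → Tm → Ty → Ty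
  substTy k s (Π A B) = Π (substTy k s A) (substTy (suc k) s B)
  substTy k s (Σ A B) = Σ (substTy k s A) (substTy (suc k) s B)
  substTy k s 𝟙       = 𝟙
  substTy k s 𝟘       = 𝟘
  substTy k s (A ⊕ B) = substTy k s A ⊕ substTy k s B
  substTy k s U       = U
  substTy k s (El a)  = El (substTm k s a)

  substTm : ℕ → Tm → Tm → Tm
  substTm k s (var n) =
    if n <ᵇ k then var n else (if n ≡ᵇ k then shiftN k s else var (pred n))
  substTm k s (lam A t)       = lam (substTy k s A) (substTm (suc k) s t)
  substTm k s (app t u)       = app (substTm k s t) (substTm k s u)
  substTm k s (pair a b)      = pair (substTm k s a) (substTm k s b)
  substTm k s (fst p)         = fst (substTm k s p)
  substTm k s (snd p)         = snd (substTm k s p)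
  substTm k s star            = star
  substTm k s (unitrec C d t) = unitrec (substTy (suc k) s C) (substTm k s d) (substTm k s t)
  substTm k s (inl a)         = inl (substTm k s a)
  substTm k s (inr b)         = inr (substTm k s b)
  substTm k s (case C l r t)  =
    case (substTy (suc k) s C) (substTm (suc k) s l) (substTm (suc k) s r) (substTm k s t)
  substTm k s (absurd C t)    = absurd (substTy (suc k) s C) (substTm k s t)

wk : Ty → Ty
wk = wkTy 0

_[_] : Ty → Tm → Ty
B [ s ] = substTy 0 s B

_[_]ₜ : Tm → Tm → Tm
t [ s ]ₜ = substTm 0 s t

-- C [ s ]↑ : replace variable 0 by s, keeping the context length
_[_]↑ : Ty → Tm → Ty
C [ s ]↑ = substTy 0 s (wkTy 1 C)

data Ctx : Set where
  ε   : Ctx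
  _▸_ : Ctx → Ty → Ctx

infix 4 ⊢_ _⊢_type _⊢_∶_ _⊢_≣_type _⊢_≣_∶_

mutual
  data ⊢_ : Ctx → Set where
    ε-ok : ⊢ ε
    ▸-ok : ∀ {Γ A} → Γ ⊢ A type → ⊢ Γ ▸ A

  data _⊢_type : Ctx → Ty → Set where
    U-F : ∀ {Γ} → ⊢ Γ → Γ ⊢ U type
    El-F : ∀ {Γ a} → Γ ⊢ a ∶ U → Γ ⊢ El a type
    Π-F : ∀ {Γ A B} → Γ ⊢ A type → Γ ▸ A ⊢ B type → Γ ⊢ Π A B type
    Σ-F : ∀ {Γ A B} → Γ ⊢ A type → Γ ▸ A ⊢ B type → Γ ⊢ Σ A B type
    𝟙-F : ∀ {Γ} → ⊢ Γ → Γ ⊢ 𝟙 type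
    𝟘-F : ∀ {Γ} → ⊢ Γ → Γ ⊢ 𝟘 type
    ⊕-F : ∀ {Γ A B} → Γ ⊢ A type → Γ ⊢ B type → Γ ⊢ A ⊕ B type

  data _⊢_∶_ : Ctx → Tm → Ty → Set where
    var-z : ∀ {Γ A} → Γ ⊢ A type → Γ ▸ A ⊢ var 0 ∶ wk A
    var-s : ∀ {Γ A B n} → Γ ⊢ var n ∶ A → Γ ⊢ B type → Γ ▸ B ⊢ var (suc n) ∶ wk A
    conv : ∀ {Γ t A B} → Γ ⊢ t ∶ A → Γ ⊢ A ≣ B type → Γ ⊢ t ∶ B
    Π-I : ∀ {Γ A B t} → Γ ▸ A ⊢ t ∶ B → Γ ⊢ lam A t ∶ Π A B
    Π-E : ∀ {Γ A B t s} → Γ ⊢ t ∶ Π A B → Γ ⊢ s ∶ A → Γ ⊢ app t s ∶ B [ s ]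
    Σ-I : ∀ {Γ A B a b} → Γ ▸ A ⊢ B type → Γ ⊢ a ∶ A → Γ ⊢ b ∶ B [ a ] →
          Γ ⊢ pair a b ∶ Σ A B
    Σ-E₁ : ∀ {Γ A B p} → Γ ⊢ p ∶ Σ A B → Γ ⊢ fst p ∶ A
    Σ-E₂ : ∀ {Γ A B p} → Γ ⊢ p ∶ Σ A B → Γ ⊢ snd p ∶ B [ fst p ]
    𝟙-I : ∀ {Γ} → ⊢ Γ → Γ ⊢ star ∶ 𝟙
    𝟙-E : ∀ {Γ C d t} → Γ ▸ 𝟙 ⊢ C type → Γ ⊢ d ∶ C [ star ] → Γ ⊢ t ∶ 𝟙 →
          Γ ⊢ unitrec C d t ∶ C [ t ]
    ⊕-I₁ : ∀ {Γ A B a} → Γ ⊢ a ∶ A → Γ ⊢ B type → Γ ⊢ inl a ∶ A ⊕ B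
    ⊕-I₂ : ∀ {Γ A B b} → Γ ⊢ A type → Γ ⊢ b ∶ B → Γ ⊢ inr b ∶ A ⊕ B
    ⊕-E : ∀ {Γ A B C l r t} → Γ ▸ (A ⊕ B) ⊢ C type →
          Γ ▸ A ⊢ l ∶ C [ inl (var 0) ]↑ → Γ ▸ B ⊢ r ∶ C [ inr (var 0) ]↑ →
          Γ ⊢ t ∶ A ⊕ B → Γ ⊢ case C l r t ∶ C [ t ]
    𝟘-E : ∀ {Γ C t} → Γ ▸ 𝟘 ⊢ C type → Γ ⊢ t ∶ 𝟘 → Γ ⊢ absurd C t ∶ C [ t ]

  data _⊢_≣_type : Ctx → Ty → Ty → Set where
    refl-ty  : ∀ {Γ A} → Γ ⊢ A type → Γ ⊢ A ≣ A type
    sym-ty   : ∀ {Γ A B} → Γ ⊢ A ≣ B type → Γ ⊢ B ≣ A type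
    trans-ty : ∀ {Γ A B C} → Γ ⊢ A ≣ B type → Γ ⊢ B ≣ C type → Γ ⊢ A ≣ C type
    El-cong  : ∀ {Γ a b} → Γ ⊢ a ≣ b ∶ U → Γ ⊢ El a ≣ El b type
    Π-cong   : ∀ {Γ A A′ B B′} → Γ ⊢ A ≣ A′ type → Γ ▸ A ⊢ B ≣ B′ type →
               Γ ⊢ Π A B ≣ Π A′ B′ type
    Σ-cong   : ∀ {Γ A A′ B B′} → Γ ⊢ A ≣ A′ type → Γ ▸ A ⊢ B ≣ B′ type →
               Γ ⊢ Σ A B ≣ Σ A′ B′ type
    ⊕-cong   : ∀ {Γ A A′ B B′} → Γ ⊢ A ≣ A′ type → Γ ⊢ B ≣ B′ type →
               Γ ⊢ A ⊕ B ≣ A′ ⊕ B′ type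

  data _⊢_≣_∶_ : Ctx → Tm → Tm → Ty → Set where
    refl-tm  : ∀ {Γ t A} → Γ ⊢ t ∶ A → Γ ⊢ t ≣ t ∶ A
    sym-tm   : ∀ {Γ t u A} → Γ ⊢ t ≣ u ∶ A → Γ ⊢ u ≣ t ∶ A
    trans-tm : ∀ {Γ t u v A} → Γ ⊢ t ≣ u ∶ A → Γ ⊢ u ≣ v ∶ A → Γ ⊢ t ≣ v ∶ A
    conv-eq  : ∀ {Γ t u A B} → Γ ⊢ t ≣ u ∶ A → Γ ⊢ A ≣ B type → Γ ⊢ t ≣ u ∶ B
    lam-cong : ∀ {Γ A A′ B t t′} → Γ ⊢ A ≣ A′ type → Γ ▸ A ⊢ t ≣ t′ ∶ B →
               Γ ⊢ lam A t ≣ lam A′ t′ ∶ Π A B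
    app-cong : ∀ {Γ A B t t′ s s′} → Γ ⊢ t ≣ t′ ∶ Π A B → Γ ⊢ s ≣ s′ ∶ A →
               Γ ⊢ app t s ≣ app t′ s′ ∶ B [ s ]
    pair-cong : ∀ {Γ A B a a′ b b′} → Γ ▸ A ⊢ B type → Γ ⊢ a ≣ a′ ∶ A →
                Γ ⊢ b ≣ b′ ∶ B [ a ] → Γ ⊢ pair a b ≣ pair a′ b′ ∶ Σ A B
    fst-cong : ∀ {Γ A B p p′} → Γ ⊢ p ≣ p′ ∶ Σ A B → Γ ⊢ fst p ≣ fst p′ ∶ A
    snd-cong : ∀ {Γ A B p p′} → Γ ⊢ p ≣ p′ ∶ Σ A B →
               Γ ⊢ snd p ≣ snd p′ ∶ B [ fst p ]
    unitrec-cong : ∀ {Γ C C′ d d′ t t′} → Γ ▸ 𝟙 ⊢ C ≣ C′ type →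
               Γ ⊢ d ≣ d′ ∶ C [ star ] → Γ ⊢ t ≣ t′ ∶ 𝟙 →
               Γ ⊢ unitrec C d t ≣ unitrec C′ d′ t′ ∶ C [ t ]
    inl-cong : ∀ {Γ A B a a′} → Γ ⊢ a ≣ a′ ∶ A → Γ ⊢ B type →
               Γ ⊢ inl a ≣ inl a′ ∶ A ⊕ B
    inr-cong : ∀ {Γ A B b b′} → Γ ⊢ A type → Γ ⊢ b ≣ b′ ∶ B →
               Γ ⊢ inr b ≣ inr b′ ∶ A ⊕ B
    case-cong : ∀ {Γ A B C C′ l l′ r r′ t t′} → Γ ▸ (A ⊕ B) ⊢ C ≣ C′ type →
               Γ ▸ A ⊢ l ≣ l′ ∶ C [ inl (var 0) ]↑ →
               Γ ▸ B ⊢ r ≣ r′ ∶ C [ inr (var 0) ]↑ →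
               Γ ⊢ t ≣ t′ ∶ A ⊕ B →
               Γ ⊢ case C l r t ≣ case C′ l′ r′ t′ ∶ C [ t ]
    absurd-cong : ∀ {Γ C C′ t t′} → Γ ▸ 𝟘 ⊢ C ≣ C′ type → Γ ⊢ t ≣ t′ ∶ 𝟘 →
               Γ ⊢ absurd C t ≣ absurd C′ t′ ∶ C [ t ]
    Π-β : ∀ {Γ A B t s} → Γ ▸ A ⊢ t ∶ B → Γ ⊢ s ∶ A →
          Γ ⊢ app (lam A t) s ≣ t [ s ]ₜ ∶ B [ s ]
    Σ-β₁ : ∀ {Γ A B a b} → Γ ▸ A ⊢ B type → Γ ⊢ a ∶ A → Γ ⊢ b ∶ B [ a ] →
           Γ ⊢ fst (pair a b) ≣ a ∶ A
    Σ-β₂ : ∀ {Γ A B a b} → Γ ▸ A ⊢ B type → Γ ⊢ a ∶ A → Γ ⊢ b ∶ B [ a ] →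
           Γ ⊢ snd (pair a b) ≣ b ∶ B [ a ]
    𝟙-β : ∀ {Γ C d} → Γ ▸ 𝟙 ⊢ C type → Γ ⊢ d ∶ C [ star ] →
          Γ ⊢ unitrec C d star ≣ d ∶ C [ star ]
    ⊕-β₁ : ∀ {Γ A B C l r a} → Γ ▸ (A ⊕ B) ⊢ C type →
           Γ ▸ A ⊢ l ∶ C [ inl (var 0) ]↑ → Γ ▸ B ⊢ r ∶ C [ inr (var 0) ]↑ →
           Γ ⊢ a ∶ A → Γ ⊢ case C l r (inl a) ≣ l [ a ]ₜ ∶ C [ inl a ]
    ⊕-β₂ : ∀ {Γ A B C l r b} → Γ ▸ (A ⊕ B) ⊢ C type →
           Γ ▸ A ⊢ l ∶ C [ inl (var 0) ]↑ → Γ ▸ B ⊢ r ∶ C [ inr (var 0) ]↑ →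
           Γ ⊢ b ∶ B → Γ ⊢ case C l r (inr b) ≣ r [ b ]ₜ ∶ C [ inr b ]

appArgs : Tm → List Tm → Tm
appArgs K′ []       = app K′ star
appArgs K′ (q ∷ qs) = foldl app (app K′ q) qs

piList : List Ty → Ty → Ty
piList []       B = B
piList (A ∷ As) B = Π A (piList As B)

sigmaList : List Ty → Ty
sigmaList []           = 𝟙
sigmaList (A ∷ [])     = A
sigmaList (A ∷ B ∷ As) = Σ A (sigmaList (B ∷ As))

module _ (L : FOLDSSig) where
  open FOLDSSig L

  -- Inside T_K (K = K_{j+1}, j = toℕ K) the context is
  --   K_1, …, K_j, f_1, …, f_i      (i = toℕ f for the type of variable f)
  -- so object variable K_l has de Bruijn index i + (j ∸ suc l)
  -- and arrow variable f_a has de Bruijn index i ∸ suc a.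

  -- the type  El(app[K_f (p f)_{p ∈ K_f//L}])  of the variable f ∈ K//L
  arrowTy : (K : Fin m) → Fin (deg K) → Ty
  arrowTy K f =
    El (appArgs (var (toℕ f + (toℕ K ∸ suc (toℕ (cod K f)))))
                (map (λ p → var (toℕ f ∸ suc (toℕ (comp K f p))))
                     (allFin (deg (cod K f)))))

  TyFrom : (n : ℕ) → (Fin n → Ty) → Ty
  TyFrom zero    A = Π 𝟙 U
  TyFrom (suc n) A = piList (map A (allFin (suc n))) U

  T : Fin m → Ty
  T K = TyFrom (deg K) (arrowTy K)

  Struc : Ty
  Struc = sigmaList (map T (allFin m))

-- Each entry T_K of Struc(L) is a Π-telescope of atomic types El(app[K_f (p f)_p]) whose free
-- variables are earlier entries.  Writing atomic types with the context variables as de Bruijn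
-- levels and the variables of the telescope locally nameless, weakening leaves them unchanged and
-- Π-elimination merely instantiates the first bound variable.  Applying K_f to the variables p f
-- one at a time, the type then required of p f is El(app[cod p ((r p) f)_r]); this is the type
-- El(app[cod (p f) (r (p f))_r]) with which p f was declared, since cod (p f) = cod p and
-- composition is associative.  The proper order lists every codomain before its domain, so each
-- variable is declared before it is used.

module Submission where

open import Data.Bool using (true; false)
open import Data.Empty using (⊥-elim)
open import Data.Fin using (Fin; toℕ; zero; suc)
open import Data.Fin.Properties using (toℕ-injective)
open import Data.List using (List; []; _∷_; map; foldl; tabulate; allFin)
open import Data.List.Properties using (map-∘; map-cong; map-cong-local; map-tabulate)
open import Data.List.Relation.Unary.All as All using (All; []; _∷_)
open import Data.List.Relation.Unary.All.Properties using (map⁺; tabulate⁺)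
open import Data.Nat using (ℕ; zero; suc; _+_; _∸_; _<_; _≤_; _<ᵇ_; _≡ᵇ_; pred; z≤n; s≤s)
open import Data.Nat.Properties
open import Data.Product using (_×_; _,_; proj₁; Σ-syntax)
open import Data.Sum using (_⊎_; inj₁; inj₂)
open import Data.Unit using (⊤; tt)
open import Function using (_∘_; id)
open import Relation.Binary.PropositionalEquality
open import Relation.Nullary.Reflects using (ofʸ; ofⁿ)

open import Defs

wkTm-var< : ∀ {c n} → n < c → wkTm c (var n) ≡ var n
wkTm-var< {c} {n} n<c with n <ᵇ c | <ᵇ-reflects-< n c
... | true  | _        = refl
... | false | ofⁿ n≮c = ⊥-elim (n≮c n<c)

wkTm-var≥ : ∀ {c n} → c ≤ n → wkTm c (var n) ≡ var (suc n)
wkTm-var≥ {c} {n} c≤n with n <ᵇ c | <ᵇ-reflects-< n c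
... | true  | ofʸ n<c = ⊥-elim (<⇒≱ n<c c≤n)
... | false | _       = refl

substTm-var< : ∀ {k s n} → n < k → substTm k s (var n) ≡ var n
substTm-var< {k} {s} {n} n<k with n <ᵇ k | <ᵇ-reflects-< n k
... | true  | _        = refl
... | false | ofⁿ n≮k = ⊥-elim (n≮k n<k)

shiftN-var : ∀ k x → shiftN k (var x) ≡ var (k + x)
shiftN-var zero    x = refl
shiftN-var (suc k) x rewrite shiftN-var k x = refl

substTm-var≡ : ∀ {k x} → substTm k (var x) (var k) ≡ var (k + x)
substTm-var≡ {k} {x} with k <ᵇ k | <ᵇ-reflects-< k k
... | true  | ofʸ k<k = ⊥-elim (n≮n k k<k)
... | false | _ with k ≡ᵇ k | ≡⇒≡ᵇ k k refl
...   | true | _ = shiftN-var k x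

substTm-var> : ∀ {k s n} → k < n → substTm k s (var n) ≡ var (pred n)
substTm-var> {k} {s} {n} k<n with n <ᵇ k | <ᵇ-reflects-< n k
... | true  | ofʸ n<k = ⊥-elim (<-asym k<n n<k)
... | false | _ with n ≡ᵇ k | ≡ᵇ⇒≡ n k
...   | true  | n≡k = ⊥-elim (<⇒≢ k<n (sym (n≡k tt)))
...   | false | _   = refl

module _ {F : Tm → Tm} (F-app : ∀ t u → F (app t u) ≡ app (F t) (F u)) where

  foldl-app-natural : ∀ t ts → F (foldl app t ts) ≡ foldl app (F t) (map F ts)
  foldl-app-natural t []       = refl
  foldl-app-natural t (u ∷ us) =
    trans (foldl-app-natural (app t u) us) (cong (λ s → foldl app s (map F us)) (F-app t u))

  appArgs-natural : F star ≡ star → ∀ t ts → F (appArgs t ts) ≡ appArgs (F t) (map F ts)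
  appArgs-natural F-star t []       = trans (F-app t star) (cong (app (F t)) F-star)
  appArgs-natural F-star t (u ∷ us) = foldl-app-natural t (u ∷ us)

-- A variable of an atomic type in a telescope, in locally nameless style: `free x` is the
-- context variable of de Bruijn level x, `bound r` the r-th binder of the telescope.  Read in a
-- context of length m under d binders of the telescope, this is exactly the indexing of arrowTy.
data Var (k : ℕ) : Set where
  free  : ℕ → Var k
  bound : Fin k → Var k

⟦_⟧ᵛ : ∀ {k} → Var k → ℕ → ℕ → Tm
⟦ free x  ⟧ᵛ m d = var (d + (m ∸ suc x))
⟦ bound r ⟧ᵛ m d = var (d ∸ suc (toℕ r))

Scoped : ∀ {k} → ℕ → ℕ → Var k → Set
Scoped m d (free x)  = x < m
Scoped m d (bound r) = toℕ r < d

instantiate : ∀ {k} → ℕ → Var (suc k) → Var k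
instantiate y (free x)        = free x
instantiate y (bound zero)    = free y
instantiate y (bound (suc r)) = bound r

ground : ∀ {k} → (Fin k → ℕ) → Var k → Var 0
ground Y (free x)  = free x
ground Y (bound r) = free (Y r)

wk-var : ∀ {k m d} (v : Var k) → Scoped m d v → wkTm d (⟦ v ⟧ᵛ m d) ≡ ⟦ v ⟧ᵛ (suc m) d
wk-var {m = m} {d} (free x) x<m = begin
  wkTm d (var (d + (m ∸ suc x))) ≡⟨ wkTm-var≥ (m≤m+n d _) ⟩
  var (suc (d + (m ∸ suc x)))    ≡⟨ cong var (sym (+-suc d _)) ⟩
  var (d + suc (m ∸ suc x))      ≡⟨ cong (λ n → var (d + n)) (sym (+-∸-assoc 1 x<m)) ⟩
  var (d + (m ∸ x))              ∎
  where open ≡-Reasoning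
wk-var {d = d} (bound r) r<d = wkTm-var< (∸-monoʳ-< (s≤s z≤n) r<d)

subst-var : ∀ {k m d y} (v : Var (suc k)) → Scoped m (suc d) v →
            substTm d (var (m ∸ suc y)) (⟦ v ⟧ᵛ m (suc d)) ≡ ⟦ instantiate y v ⟧ᵛ m d
subst-var {d = d} (free x)        _         = substTm-var> (s≤s (m≤m+n d _))
subst-var {d = d} (bound zero)    _         = substTm-var≡ {d}
subst-var {d = d} (bound (suc r)) (s≤s r<d) = substTm-var< (∸-monoʳ-< (s≤s z≤n) r<d)

ground-instantiate : ∀ {k} (Y : Fin (suc k) → ℕ) (v : Var (suc k)) →
                     ground (Y ∘ suc) (instantiate (Y zero) v) ≡ ground Y v
ground-instantiate Y (free x)        = refl
ground-instantiate Y (bound zero)    = refl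
ground-instantiate Y (bound (suc r)) = refl

-- El(app[x (y₁,…,y_k)])
record Atom (k : ℕ) : Set where
  constructor _⦅_⦆
  field
    head : Var k
    args : List (Var k)

vars : ∀ {k} → Atom k → List (Var k)
vars (h ⦅ as ⦆) = h ∷ as

mapAtom : ∀ {k k′} → (Var k → Var k′) → Atom k → Atom k′
mapAtom g (h ⦅ as ⦆) = g h ⦅ map g as ⦆

appᵃ : ∀ {k} → (Var k → Tm) → Atom k → Tm
appᵃ ρ (h ⦅ as ⦆) = appArgs (ρ h) (map ρ as)

El⟦_⟧ : ∀ {k} → Atom k → ℕ → ℕ → Ty
El⟦ a ⟧ m d = El (appᵃ (λ v → ⟦ v ⟧ᵛ m d) a)

appᵃ-natural : ∀ {k} (F : Tm → Tm) → (∀ t u → F (app t u) ≡ app (F t) (F u)) → F star ≡ star →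
               ∀ {ρ σ : Var k → Tm} a → All (λ v → F (ρ v) ≡ σ v) (vars a) → F (appᵃ ρ a) ≡ appᵃ σ a
appᵃ-natural F F-app F-star {ρ} (h ⦅ as ⦆) (Fh ∷ Fas) = begin
  F (appArgs (ρ h) (map ρ as))           ≡⟨ appArgs-natural F-app F-star (ρ h) (map ρ as) ⟩
  appArgs (F (ρ h)) (map F (map ρ as))   ≡⟨ cong₂ appArgs Fh (trans (sym (map-∘ as)) (map-cong-local Fas)) ⟩
  appArgs _ (map _ as)                   ∎
  where open ≡-Reasoning

appᵃ-mapAtom : ∀ {k k′} (ρ : Var k′ → Tm) (g : Var k → Var k′) a → appᵃ ρ (mapAtom g a) ≡ appᵃ (ρ ∘ g) a
appᵃ-mapAtom ρ g (h ⦅ as ⦆) = cong (appArgs (ρ (g h))) (sym (map-∘ as))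

mapAtom-∘ : ∀ {k k′ k″} (f : Var k′ → Var k″) (g : Var k → Var k′) a →
            mapAtom f (mapAtom g a) ≡ mapAtom (f ∘ g) a
mapAtom-∘ f g (h ⦅ as ⦆) = cong (f (g h) ⦅_⦆) (sym (map-∘ as))

mapAtom-cong : ∀ {k k′} {f g : Var k → Var k′} → (∀ v → f v ≡ g v) → ∀ a → mapAtom f a ≡ mapAtom g a
mapAtom-cong f≗g (h ⦅ as ⦆) = cong₂ _⦅_⦆ (f≗g h) (map-cong f≗g as)

wk-El⟦⟧ : ∀ {k m} d (a : Atom k) → All (Scoped m d) (vars a) → wkTy d (El⟦ a ⟧ m d) ≡ El⟦ a ⟧ (suc m) d
wk-El⟦⟧ d a sc = cong El (appᵃ-natural (wkTm d) (λ _ _ → refl) refl a (All.map (λ {v} → wk-var v) sc))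

subst-El⟦⟧ : ∀ {k m} d {y} (a : Atom (suc k)) → All (Scoped m (suc d)) (vars a) →
             substTy d (var (m ∸ suc y)) (El⟦ a ⟧ m (suc d)) ≡ El⟦ mapAtom (instantiate y) a ⟧ m d
subst-El⟦⟧ {m = m} d {y} a sc = cong El (trans
  (appᵃ-natural (substTm d (var (m ∸ suc y))) (λ _ _ → refl) refl a (All.map (λ {v} → subst-var v) sc))
  (sym (appᵃ-mapAtom _ (instantiate y) a)))

-- Reading the telescope variables as the context variables of levels j, j + 1, ….
El⟦⟧-ground : ∀ {k} j i (a : Atom k) → All (Scoped j i) (vars a) →
              El⟦ a ⟧ j i ≡ El⟦ mapAtom (ground (λ r → j + toℕ r)) a ⟧ (j + i) 0
El⟦⟧-ground j i a sc = cong El (trans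
  (appᵃ-natural id (λ _ _ → refl) refl a (All.map (λ {v} → ground-var v) sc))
  (sym (appᵃ-mapAtom _ _ a)))
  where
    ground-var : ∀ {k} (v : Var k) → Scoped j i v →
                 ⟦ v ⟧ᵛ j i ≡ ⟦ ground (λ r → j + toℕ r) v ⟧ᵛ (j + i) 0
    ground-var (free x)  x<j = cong var (trans (+-comm i (j ∸ suc x)) (sym (+-∸-comm i x<j)))
    ground-var (bound r) _   = cong var (sym (trans (cong (j + i ∸_) (sym (+-suc j (toℕ r))))
                                                    ([m+n]∸[m+o]≡n∸o j i (suc (toℕ r)))))

-- Π(x₀ : A₀)⋯(x_{n-1} : A_{n-1}) U, where A₀ already lies under d binders of the telescope.
Πtel : ∀ {n k} → ℕ → ℕ → (Fin n → Atom k) → Ty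
Πtel {zero}  m d D = U
Πtel {suc n} m d D = Π (El⟦ D zero ⟧ m d) (Πtel m (suc d) (D ∘ suc))

TelScoped : ∀ {n k} → ℕ → ℕ → (Fin n → Atom k) → Set
TelScoped {zero}  m d D = ⊤
TelScoped {suc n} m d D = All (Scoped m d) (vars (D zero)) × TelScoped m (suc d) (D ∘ suc)

TelScoped-intro : ∀ {n k m} d (D : Fin n → Atom k) →
                  (∀ p → All (Scoped m (d + toℕ p)) (vars (D p))) → TelScoped m d D
TelScoped-intro {zero}  d D sc = tt
TelScoped-intro {suc n} {m = m} d D sc =
  subst (λ e → All (Scoped m e) (vars (D zero))) (+-identityʳ d) (sc zero) ,
  TelScoped-intro (suc d) (D ∘ suc)
    (λ p → subst (λ e → All (Scoped m e) (vars (D (suc p)))) (+-suc d (toℕ p)) (sc (suc p)))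

Scoped-instantiate : ∀ {k m d y} → y < m → (v : Var (suc k)) →
                     Scoped m (suc d) v → Scoped m d (instantiate y v)
Scoped-instantiate y<m (free x)        x<m       = x<m
Scoped-instantiate y<m (bound zero)    _         = y<m
Scoped-instantiate y<m (bound (suc r)) (s≤s r<d) = r<d

TelScoped-instantiate : ∀ {n k m d y} → y < m → (D : Fin n → Atom (suc k)) →
                        TelScoped m (suc d) D → TelScoped m d (mapAtom (instantiate y) ∘ D)
TelScoped-instantiate {zero}  y<m D tt         = tt
TelScoped-instantiate {suc n} y<m D (sc , scs) =
  map⁺ (All.map (λ {v} → Scoped-instantiate y<m v) sc) , TelScoped-instantiate y<m (D ∘ suc) scs

wk-Πtel : ∀ {n k m} d (D : Fin n → Atom k) → TelScoped m d D → wkTy d (Πtel m d D) ≡ Πtel (suc m) d D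
wk-Πtel {zero}  d D tt         = refl
wk-Πtel {suc n} d D (sc , scs) = cong₂ Π (wk-El⟦⟧ d (D zero) sc) (wk-Πtel (suc d) (D ∘ suc) scs)

subst-Πtel : ∀ {n k m} d {y} (D : Fin n → Atom (suc k)) → TelScoped m (suc d) D →
             substTy d (var (m ∸ suc y)) (Πtel m (suc d) D) ≡ Πtel m d (mapAtom (instantiate y) ∘ D)
subst-Πtel {zero}  d D tt         = refl
subst-Πtel {suc n} d D (sc , scs) = cong₂ Π (subst-El⟦⟧ d (D zero) sc) (subst-Πtel (suc d) (D ∘ suc) scs)

-- The variable of de Bruijn level x in a context of length m.
lv : ℕ → ℕ → Tm
lv m x = var (m ∸ suc x)

El⟦⟧-ground-closed : ∀ {k m} (Y : Fin k → ℕ) (a : Atom k) → All (Scoped m 0) (vars a) →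
                     El⟦ mapAtom (ground Y) a ⟧ m 0 ≡ El⟦ a ⟧ m 0
El⟦⟧-ground-closed {m = m} Y a sc = cong El (trans (appᵃ-mapAtom _ (ground Y) a)
  (appᵃ-natural id (λ _ _ → refl) refl a (All.map (λ {v} → closed v) sc)))
  where
    closed : ∀ v → Scoped m 0 v → ⟦ ground Y v ⟧ᵛ m 0 ≡ ⟦ v ⟧ᵛ m 0
    closed (free x)  _  = refl
    closed (bound r) ()

Πtel-apply : ∀ {n Γ m t} (D : Fin n → Atom n) (Y : Fin n → ℕ) →
             TelScoped m 0 D → (∀ p → Y p < m) →
             (∀ p → Γ ⊢ lv m (Y p) ∶ El⟦ mapAtom (ground Y) (D p) ⟧ m 0) →
             Γ ⊢ t ∶ Πtel m 0 D → Γ ⊢ foldl app t (tabulate (lv m ∘ Y)) ∶ U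
Πtel-apply {zero}              D Y _          _   _     ⊢t = ⊢t
Πtel-apply {suc n} {Γ} {m} {t} D Y (sc , scs) Y<m ⊢args ⊢t =
  Πtel-apply D′ (Y ∘ suc) (TelScoped-instantiate (Y<m zero) (D ∘ suc) scs) (Y<m ∘ suc) ⊢args′ ⊢t·y₀
  where
    D′ : Fin n → Atom n
    D′ = mapAtom (instantiate (Y zero)) ∘ D ∘ suc

    ⊢y₀ : Γ ⊢ lv m (Y zero) ∶ El⟦ D zero ⟧ m 0
    ⊢y₀ = subst (Γ ⊢ lv m (Y zero) ∶_) (El⟦⟧-ground-closed Y (D zero) sc) (⊢args zero)

    ⊢t·y₀ : Γ ⊢ app t (lv m (Y zero)) ∶ Πtel m 0 D′
    ⊢t·y₀ = subst (Γ ⊢ app t (lv m (Y zero)) ∶_) (subst-Πtel 0 (D ∘ suc) scs) (Π-E ⊢t ⊢y₀)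

    ⊢args′ : ∀ p → Γ ⊢ lv m (Y (suc p)) ∶ El⟦ mapAtom (ground (Y ∘ suc)) (D′ p) ⟧ m 0
    ⊢args′ p = subst (λ a → Γ ⊢ lv m (Y (suc p)) ∶ El⟦ a ⟧ m 0)
      (sym (trans (mapAtom-∘ _ _ (D (suc p))) (mapAtom-cong (ground-instantiate Y) (D (suc p)))))
      (⊢args (suc p))

-- T_K, with the convention T_K = 𝟙 → U for empty K//L.
TelU : ∀ {n} → ℕ → (Fin n → Atom n) → Ty
TelU {zero}  m D = Π 𝟙 U
TelU {suc n} m D = Πtel m 0 D

TelU-apply : ∀ {n Γ m t} (D : Fin n → Atom n) (Y : Fin n → ℕ) → ⊢ Γ →
             TelScoped m 0 D → (∀ p → Y p < m) →
             (∀ p → Γ ⊢ lv m (Y p) ∶ El⟦ mapAtom (ground Y) (D p) ⟧ m 0) →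
             Γ ⊢ t ∶ TelU m D → Γ ⊢ appArgs t (map (lv m ∘ Y) (allFin n)) ∶ U
TelU-apply {zero}  D Y ⊢Γ _  _   _     ⊢t = Π-E ⊢t (𝟙-I ⊢Γ)
TelU-apply {suc n} {Γ} {m} {t} D Y ⊢Γ sc Y<m ⊢args ⊢t =
  subst (λ ts → Γ ⊢ appArgs t ts ∶ U) (sym (map-tabulate id (lv m ∘ Y))) (Πtel-apply D Y sc Y<m ⊢args ⊢t)

wk-TelU : ∀ {n m} (D : Fin n → Atom n) → TelScoped m 0 D → wk (TelU m D) ≡ TelU (suc m) D
wk-TelU {zero}  D _  = refl
wk-TelU {suc n} D sc = wk-Πtel 0 D sc

piList-tabulate : ∀ {n k m} d (A : Fin n → Ty) (D : Fin n → Atom k) →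
                  (∀ p → A p ≡ El⟦ D p ⟧ m (d + toℕ p)) → piList (tabulate A) U ≡ Πtel m d D
piList-tabulate {zero}          d A D A≡ = refl
piList-tabulate {suc n} {m = m} d A D A≡ = cong₂ Π
  (trans (A≡ zero) (cong (El⟦ D zero ⟧ m) (+-identityʳ d)))
  (piList-tabulate (suc d) (A ∘ suc) (D ∘ suc)
    (λ p → trans (A≡ (suc p)) (cong (El⟦ D (suc p) ⟧ m) (+-suc d (toℕ p)))))

TyFrom≡TelU : ∀ L {n m} (A : Fin n → Ty) (D : Fin n → Atom n) →
              (∀ p → A p ≡ El⟦ D p ⟧ m (toℕ p)) → TyFrom L n A ≡ TelU m D
TyFrom≡TelU L {zero}  A D A≡ = refl
TyFrom≡TelU L {suc n} A D A≡ =
  trans (cong (λ As → piList As U) (map-tabulate id A)) (piList-tabulate 0 A D A≡)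

len : Ctx → ℕ
len ε       = 0
len (Γ ▸ A) = suc (len Γ)

var-new : ∀ {Γ A} → Γ ⊢ A type → Γ ▸ A ⊢ lv (suc (len Γ)) (len Γ) ∶ wk A
var-new {Γ} {A} ⊢A = subst (λ i → Γ ▸ A ⊢ var i ∶ wk A) (sym (n∸n≡0 (len Γ))) (var-z ⊢A)

var-old : ∀ {Γ A B x} → x < len Γ → Γ ⊢ lv (len Γ) x ∶ B → Γ ⊢ A type →
          Γ ▸ A ⊢ lv (suc (len Γ)) x ∶ wk B
var-old {Γ} {A} {B} x<len ⊢x ⊢A =
  subst (λ i → Γ ▸ A ⊢ var i ∶ wk B) (sym (+-∸-assoc 1 x<len)) (var-s ⊢x ⊢A)

-- τ n M is the type of the variable named n, of de Bruijn level `level n`, in a context of length M.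
module LevelTyping {Name : Set} (level : Name → ℕ) (τ : Name → ℕ → Ty)
                   (τ-wk : ∀ n {M} → level n < M → wk (τ n M) ≡ τ n (suc M)) where

  Typed : Ctx → Set
  Typed Γ = ⊢ Γ × (∀ n → level n < len Γ → Γ ⊢ lv (len Γ) (level n) ∶ τ n (len Γ))

  Declares : Ctx → Ty → Set
  Declares Γ A = Γ ⊢ A type × (∀ n → level n ≡ len Γ → wk A ≡ τ n (suc (len Γ)))

  Typed-▸ : ∀ {Γ A} → Typed Γ → Declares Γ A → Typed (Γ ▸ A)
  Typed-▸ {Γ} {A} (_ , ⊢vars) (⊢A , wkA) = ▸-ok ⊢A , ⊢vars′
    where
      ⊢vars′ : ∀ n → level n < suc (len Γ) → Γ ▸ A ⊢ lv (suc (len Γ)) (level n) ∶ τ n (suc (len Γ))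
      ⊢vars′ n lt with m<1+n⇒m<n∨m≡n lt
      ... | inj₁ old = subst (Γ ▸ A ⊢ lv (suc (len Γ)) (level n) ∶_) (τ-wk n old)
                         (var-old old (⊢vars n old) ⊢A)
      ... | inj₂ new = subst₂ (λ x B → Γ ▸ A ⊢ lv (suc (len Γ)) x ∶ B) (sym new) (wkA n new)
                         (var-new ⊢A)

  Declarations : ∀ {k} → Ctx → (Fin k → Ty) → Set
  Declarations Γ D = ∀ p {Δ} → Typed Δ → len Δ ≡ len Γ + toℕ p → Declares Δ (D p)

  Declarations-tail : ∀ {k Γ A} (D : Fin (suc k) → Ty) →
                      Declarations Γ D → Declarations (Γ ▸ A) (D ∘ suc)
  Declarations-tail {Γ = Γ} D decls p ⊢Δ e = decls (suc p) ⊢Δ (trans e (sym (+-suc (len Γ) (toℕ p))))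

  piList-type : ∀ {k Γ} (D : Fin k → Ty) → Typed Γ → Declarations Γ D → Γ ⊢ piList (tabulate D) U type
  piList-type {zero}      D (⊢Γ , _) _ = U-F ⊢Γ
  piList-type {suc k} {Γ} D ⊢Γ decls =
    Π-F (proj₁ D₀) (piList-type (D ∘ suc) (Typed-▸ ⊢Γ D₀) (Declarations-tail {A = D zero} D decls))
    where D₀ = decls zero ⊢Γ (sym (+-identityʳ (len Γ)))

  sigmaList-type : ∀ {k Γ} (D : Fin k → Ty) → Typed Γ → Declarations Γ D → Γ ⊢ sigmaList (tabulate D) type
  sigmaList-type {zero}            D (⊢Γ , _) _ = 𝟙-F ⊢Γ
  sigmaList-type {suc zero} {Γ}    D ⊢Γ decls = proj₁ (decls zero ⊢Γ (sym (+-identityʳ (len Γ))))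
  sigmaList-type {suc (suc k)} {Γ} D ⊢Γ decls =
    Σ-F (proj₁ D₀) (sigmaList-type (D ∘ suc) (Typed-▸ ⊢Γ D₀) (Declarations-tail {A = D zero} D decls))
    where D₀ = decls zero ⊢Γ (sym (+-identityʳ (len Γ)))

  TyFrom-type : ∀ L {k Γ} (D : Fin k → Ty) → Typed Γ → Declarations Γ D → Γ ⊢ TyFrom L k D type
  TyFrom-type L {zero}      D (⊢Γ , _) _ = Π-F (𝟙-F ⊢Γ) (U-F (▸-ok (𝟙-F ⊢Γ)))
  TyFrom-type L {suc k} {Γ} D ⊢Γ decls =
    subst (λ Ds → Γ ⊢ piList Ds U type) (sym (map-tabulate id D)) (piList-type D ⊢Γ decls)

module _ (L : FOLDSSig) where
  open FOLDSSig L

  cod<K : ∀ K f → toℕ (cod K f) < toℕ K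
  cod<K K f = ≺⇒< (cod≺ K f)

  comp<f : ∀ K f p → toℕ (comp K f p) < toℕ f
  comp<f K f p = ⊏⇒< (cod≺⇒⊏ (subst (_≺ cod K f) (sym (cod-comp K f p)) (cod≺ (cod K f) p)))

  map-allFin-subst : ∀ {A : Set} {X Y : Fin m} (e : X ≡ Y) (G : Fin (deg X) → A) →
                     map G (allFin (deg X)) ≡ map (G ∘ subst (λ Z → Fin (deg Z)) (sym e)) (allFin (deg Y))
  map-allFin-subst refl G = refl

  map-comp-assoc : ∀ {A : Set} K f p (F : Fin (deg K) → A) →
                   map (F ∘ comp K (comp K f p)) (allFin _) ≡ map (F ∘ comp K f ∘ comp (cod K f) p) (allFin _)
  map-comp-assoc K f p F =
    trans (map-allFin-subst (cod-comp K f p) _) (map-cong (λ r → cong F (comp-assoc K f p r)) _)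

  arrowAtom : (K : Fin m) → Fin (deg K) → Atom (deg K)
  arrowAtom K f = free (toℕ (cod K f)) ⦅ map (bound ∘ comp K f) (allFin _) ⦆

  arrowTy≡El⟦⟧ : ∀ K f → arrowTy L K f ≡ El⟦ arrowAtom K f ⟧ (toℕ K) (toℕ f)
  arrowTy≡El⟦⟧ K f = cong (El ∘ appArgs (var (toℕ f + (toℕ K ∸ suc (toℕ (cod K f))))))
    (map-∘ {g = λ (v : Var (deg K)) → ⟦ v ⟧ᵛ (toℕ K) (toℕ f)} (allFin (deg (cod K f))))

  arrowAtom-scoped : ∀ {M} K → toℕ K ≤ M → ∀ f → All (Scoped M (toℕ f)) (vars (arrowAtom K f))
  arrowAtom-scoped K K≤M f = <-≤-trans (cod<K K f) K≤M ∷ map⁺ (tabulate⁺ (comp<f K f))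

  arrowTel-scoped : ∀ {M} K → toℕ K ≤ M → TelScoped M 0 (arrowAtom K)
  arrowTel-scoped K K≤M = TelScoped-intro 0 (arrowAtom K) (arrowAtom-scoped K K≤M)

  T≡TelU : ∀ K → T L K ≡ TelU (toℕ K) (arrowAtom K)
  T≡TelU K = TyFrom≡TelU L (arrowTy L K) (arrowAtom K) (arrowTy≡El⟦⟧ K)

  module Objects = LevelTyping toℕ (λ K M → TelU M (arrowAtom K))
                     (λ K K<M → wk-TelU (arrowAtom K) (arrowTel-scoped K (<⇒≤ K<M)))

  module Arrows (K : Fin m) where
    j : ℕ
    j = toℕ K

    groundArrowAtom : Fin (deg K) → Atom 0
    groundArrowAtom q = mapAtom (ground (λ r → j + toℕ r)) (arrowAtom K q)

    groundArrowAtom-scoped : ∀ {M} q → j + toℕ q ≤ M → All (Scoped M 0) (vars (groundArrowAtom q))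
    groundArrowAtom-scoped {M} q q≤M =
      map⁺ (All.map (λ {v} → grounded v) (arrowAtom-scoped K (≤-trans (m≤m+n j _) q≤M) q))
      where
        grounded : ∀ v → Scoped M (toℕ q) v → Scoped M 0 (ground (λ r → j + toℕ r) v)
        grounded (free x)  x<M = x<M
        grounded (bound r) r<q = <-≤-trans (+-monoʳ-< j r<q) q≤M

    arrowTy-ground : ∀ f → arrowTy L K f ≡ El⟦ groundArrowAtom f ⟧ (j + toℕ f) 0
    arrowTy-ground f =
      trans (arrowTy≡El⟦⟧ K f) (El⟦⟧-ground j (toℕ f) (arrowAtom K f) (arrowAtom-scoped K ≤-refl f))

    -- The declared type of p ∘ f is the type that K_f expects of its p-th argument.
    groundArrowAtom-comp : ∀ f p → groundArrowAtom (comp K f p) ≡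
                           mapAtom (ground (λ r → j + toℕ (comp K f r))) (arrowAtom (cod K f) p)
    groundArrowAtom-comp f p = cong₂ _⦅_⦆ (cong (free ∘ toℕ) (cod-comp K f p))
      (trans (sym (map-∘ (allFin _)))
             (trans (map-comp-assoc K f p (λ r → free (j + toℕ r))) (map-∘ (allFin _))))

    Name : Set
    Name = (Σ[ K′ ∈ Fin m ] toℕ K′ < j) ⊎ Fin (deg K)

    level : Name → ℕ
    level (inj₁ (K′ , _)) = toℕ K′
    level (inj₂ q)        = j + toℕ q

    τ : Name → ℕ → Ty
    τ (inj₁ (K′ , _)) M = TelU M (arrowAtom K′)
    τ (inj₂ q)        M = El⟦ groundArrowAtom q ⟧ M 0

    τ-wk : ∀ n {M} → level n < M → wk (τ n M) ≡ τ n (suc M)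
    τ-wk (inj₁ (K′ , _)) K′<M = wk-TelU (arrowAtom K′) (arrowTel-scoped K′ (<⇒≤ K′<M))
    τ-wk (inj₂ q)        q<M  = wk-El⟦⟧ 0 (groundArrowAtom q) (groundArrowAtom-scoped q (<⇒≤ q<M))

    open LevelTyping level τ τ-wk public

    Typed-objects : ∀ {Γ} → len Γ ≡ j → Objects.Typed Γ → Typed Γ
    Typed-objects {Γ} e (⊢Γ , ⊢objects) = ⊢Γ , ⊢vars
      where
        ⊢vars : ∀ n → level n < len Γ → Γ ⊢ lv (len Γ) (level n) ∶ τ n (len Γ)
        ⊢vars (inj₁ (K′ , _)) K′<len = ⊢objects K′ K′<len
        ⊢vars (inj₂ q)        q<len  = ⊥-elim (m+n≮m j (toℕ q) (subst (j + toℕ q <_) e q<len))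

    arrowTy-type : ∀ f {Δ} → Typed Δ → len Δ ≡ j + toℕ f → Δ ⊢ arrowTy L K f type
    arrowTy-type f {Δ} (⊢Δ , ⊢vars) e = subst (Δ ⊢_type) (sym arrowTy≡) (El-F ⊢application)
      where
        h = cod K f
        N = len Δ

        Y : Fin (deg h) → ℕ
        Y p = j + toℕ (comp K f p)

        h<N : toℕ h < N
        h<N = <-≤-trans (cod<K K f) (subst (j ≤_) (sym e) (m≤m+n j _))

        Y<N : ∀ p → Y p < N
        Y<N p = subst (Y p <_) (sym e) (+-monoʳ-< j (comp<f K f p))

        ⊢head : Δ ⊢ lv N (toℕ h) ∶ TelU N (arrowAtom h)
        ⊢head = ⊢vars (inj₁ (h , cod<K K f)) h<N

        ⊢args : ∀ p → Δ ⊢ lv N (Y p) ∶ El⟦ mapAtom (ground Y) (arrowAtom h p) ⟧ N 0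
        ⊢args p = subst (λ a → Δ ⊢ lv N (Y p) ∶ El⟦ a ⟧ N 0) (groundArrowAtom-comp f p)
                        (⊢vars (inj₂ (comp K f p)) (Y<N p))

        ⊢application : Δ ⊢ appArgs (lv N (toℕ h)) (map (lv N ∘ Y) (allFin (deg h))) ∶ U
        ⊢application = TelU-apply (arrowAtom h) Y ⊢Δ (arrowTel-scoped h (<⇒≤ h<N)) Y<N ⊢args ⊢head

        arrowTy≡ : arrowTy L K f ≡ El (appArgs (lv N (toℕ h)) (map (lv N ∘ Y) (allFin (deg h))))
        arrowTy≡ = begin
          arrowTy L K f                                   ≡⟨ arrowTy-ground f ⟩
          El⟦ groundArrowAtom f ⟧ (j + toℕ f) 0           ≡⟨ cong (λ M → El⟦ groundArrowAtom f ⟧ M 0) (sym e) ⟩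
          El (appᵃ (λ v → ⟦ v ⟧ᵛ N 0) (groundArrowAtom f)) ≡⟨ cong El (appᵃ-mapAtom _ _ (arrowAtom K f)) ⟩
          El (appArgs (lv N (toℕ h)) (map _ (map (bound ∘ comp K f) (allFin (deg h)))))
            ≡⟨ cong (El ∘ appArgs (lv N (toℕ h))) (sym (map-∘ (allFin (deg h)))) ⟩
          El (appArgs (lv N (toℕ h)) (map (lv N ∘ Y) (allFin (deg h))))  ∎
          where open ≡-Reasoning

    arrowTy-declarations : ∀ {Γ} → len Γ ≡ j → Declarations Γ (arrowTy L K)
    arrowTy-declarations {Γ} e f {Δ} ⊢Δ e′ = arrowTy-type f ⊢Δ len≡ , declared
      where
        len≡ : len Δ ≡ j + toℕ f
        len≡ = trans e′ (cong (_+ toℕ f) e)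

        declared : ∀ n → level n ≡ len Δ → wk (arrowTy L K f) ≡ τ n (suc (len Δ))
        declared (inj₁ (K′ , K′<j)) K′≡ =
          ⊥-elim (<⇒≱ K′<j (subst (j ≤_) (sym (trans K′≡ len≡)) (m≤m+n j _)))
        declared (inj₂ q)           q≡ with toℕ-injective (+-cancelˡ-≡ j _ _ (trans q≡ len≡))
        ... | refl = begin
          wk (arrowTy L K f)
            ≡⟨ cong wk (arrowTy-ground f) ⟩
          wk (El⟦ groundArrowAtom f ⟧ (j + toℕ f) 0)
            ≡⟨ wk-El⟦⟧ 0 (groundArrowAtom f) (groundArrowAtom-scoped f ≤-refl) ⟩
          El⟦ groundArrowAtom f ⟧ (suc (j + toℕ f)) 0
            ≡⟨ cong (λ M → El⟦ groundArrowAtom f ⟧ (suc M) 0) (sym len≡) ⟩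
          El⟦ groundArrowAtom f ⟧ (suc (len Δ)) 0     ∎
          where open ≡-Reasoning

  T-declarations : Objects.Declarations ε (T L)
  T-declarations K {Γ} ⊢Γ e =
    TyFrom-type L (arrowTy L K) (Typed-objects e ⊢Γ) (arrowTy-declarations e) , declared
    where
      open Arrows K

      declared : ∀ K′ → toℕ K′ ≡ len Γ → wk (T L K) ≡ TelU (suc (len Γ)) (arrowAtom K′)
      declared K′ K′≡ with toℕ-injective (trans K′≡ e)
      ... | refl = begin
        wk (T L K)                            ≡⟨ cong wk (T≡TelU K) ⟩
        wk (TelU (toℕ K) (arrowAtom K))       ≡⟨ wk-TelU (arrowAtom K) (arrowTel-scoped K ≤-refl) ⟩
        TelU (suc (toℕ K)) (arrowAtom K)      ≡⟨ cong (λ M → TelU (suc M) (arrowAtom K)) (sym e) ⟩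
        TelU (suc (len Γ)) (arrowAtom K)      ∎
        where open ≡-Reasoning

theorem2p9 : (L : FOLDSSig) → ε ⊢ Struc L type
theorem2p9 L = subst (λ Ts → ε ⊢ sigmaList Ts type) (sym (map-tabulate id (T L)))
  (sigmaList-type (T L) (ε-ok , λ _ ()) (T-declarations L))
  where open Objects L
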